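{- Let $\mathcal{E},\mathcal{F},\mathcal{Q}$ be vector bundles on the Fargues–Fontaine curve $X$ such that: (i) $\mathrm{rk}(\mathcal{E}^{\leq\mu})\geq\mathrm{rk}(\mathcal{F}^{\leq\mu})$ for all $\mu\in\mathbb{Q}$ with equality only when $\mathcal{E}^{\leq\mu}\simeq\mathcal{F}^{\leq\mu}$; (ii) $\mathrm{rk}(\mathcal{E}^{\leq\mu})\geq\mathrm{rk}(\mathcal{Q}^{\leq\mu})$ for all $\mu$ with equality only when $\mathcal{E}^{\leq\mu}\simeq\mathcal{Q}^{\leq\mu}$; (iii) $\mathrm{rk}(\mathcal{F}^{\geq\mu})\geq\mathrm{rk}(\mathcal{Q}^{\geq\mu})$ for all $\mu$; (iv) $\mu_{\min}(\mathcal{E})<\mu_{\min}(\mathcal{F})$. Let $C$ be a positive integer and let $\tilde{\mathcal{E}},\tilde{\mathcal{F}},\tilde{\mathcal{Q}}$ be vector bundles whose HN polygons are obtained by vertically stretching $\mathrm{HN}(\mathcal{E}),\mathrm{HN}(\mathcal{F}),\mathrm{HN}(\mathcal{Q})$ by the factor $C$. Then $\tilde{\mathcal{E}},\tilde{\mathcal{F}},\tilde{\mathcal{Q}}$ satisfy the same conditions (i)–(iv).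
   Context: $X$ is the Fargues–Fontaine curve attached to a finite extension $E/\mathbb{Q}_p$ and an algebraically closed perfectoid field $F$ of characteristic $p$. Every vector bundle $\mathcal{V}$ has a unique HN decomposition $\mathcal{V}\simeq\bigoplus_i\mathcal{O}(\lambda_i)^{\oplus m_i}$ ($\lambda_1>\lambda_2>\cdots$, $\mathcal{O}(\lambda)$ the stable bundle of slope $\lambda$) and is determined up to isomorphism by its HN polygon $\mathrm{HN}(\mathcal{V})$, the concave polygon from the origin to $(\mathrm{rk}\mathcal{V},\deg\mathcal{V})$ with successive edges of slopes $\lambda_i$ and horizontal lengths $m_i\,\mathrm{rk}\,\mathcal{O}(\lambda_i)$; any such polygon with integer vertices arises. Vertical stretching by $C$ means $(x,y)\mapsto(x,Cy)$. $\mu_{\min}$ is the smallest HN slope; $\mathcal{V}^{\geq\mu},\mathcal{V}^{\leq\mu}$ are the direct sums of the $\mathcal{O}(\lambda_i)^{\oplus m_i}$ with $\lambda_i\geq\mu$, resp. $\lambda_i\leq\mu$. -}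

module Defs where

open import Data.Nat as ℕ using (ℕ)
open import Data.Integer as ℤ using (ℤ; +_)
open import Data.Rational as ℚ using (ℚ; ↥_; ↧ₙ_)
open import Data.Rational.Properties using (_≤?_; _≥?_)
open import Data.Product using (_×_; _,_; proj₁; proj₂)
open import Data.List using (List; []; _∷_; map; filter; scanl; last)
open import Data.Nat.ListAction using (sum)
open import Data.List.Relation.Unary.All using (All)
open import Data.List.Relation.Unary.Linked using (Linked)
open import Data.Maybe using (Maybe; just; nothing)
open import Data.Unit using (⊤)
open import Data.Empty using (⊥)
open import Relation.Binary.PropositionalEquality using (_≡_)

-- A vector bundle on the Fargues–Fontaine curve, up to isomorphism, is
-- given by its HN decomposition  ⊕ᵢ O(λᵢ)^{mᵢ}  with λ₁ > λ₂ > ⋯ and mᵢ ≥ 1.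
-- O(λ) has rank = reduced denominator of λ and degree = reduced numerator.
HNPiece : Set
HNPiece = ℚ × ℕ   -- (slope λ, multiplicity m)

record Bundle : Set where
  constructor bundle
  field
    pieces   : List HNPiece
    decr     : Linked (λ a b → proj₁ b ℚ.< proj₁ a) pieces
    positive : All (λ a → 1 ℕ.≤ proj₂ a) pieces
open Bundle public

_≅_ : Bundle → Bundle → Set
V ≅ W = pieces V ≡ pieces W

rkO : ℚ → ℕ
rkO λ' = ↧ₙ λ'

degO : ℚ → ℤ
degO λ' = ↥ λ'

rkPieces : List HNPiece → ℕ
rkPieces ps = sum (map (λ p → proj₂ p ℕ.* rkO (proj₁ p)) ps)

rk : Bundle → ℕ
rk V = rkPieces (pieces V)

truncLe : ℚ → List HNPiece → List HNPiece
truncLe μ = filter (λ p → proj₁ p ≤? μ)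

truncGe : ℚ → List HNPiece → List HNPiece
truncGe μ = filter (λ p → proj₁ p ≥? μ)

rkLe : Bundle → ℚ → ℕ
rkLe V μ = rkPieces (truncLe μ (pieces V))

rkGe : Bundle → ℚ → ℕ
rkGe V μ = rkPieces (truncGe μ (pieces V))

IsoLe : Bundle → Bundle → ℚ → Set
IsoLe V W μ = truncLe μ (pieces V) ≡ truncLe μ (pieces W)

-- HN polygon: list of vertices (x , y) = (rank , degree), starting at the
-- origin, one vertex after each HN piece O(λ)^{m}.
HNPolygon : Set
HNPolygon = List (ℤ × ℤ)

step : ℤ × ℤ → HNPiece → ℤ × ℤ
step (x , y) (λ' , m) = (x ℤ.+ + (m ℕ.* rkO λ') , y ℤ.+ (+ m) ℤ.* degO λ')

HN : Bundle → HNPolygon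
HN V = scanl step (+ 0 , + 0) (pieces V)

stretch : ℕ → HNPolygon → HNPolygon
stretch C = map (λ v → (proj₁ v , + C ℤ.* proj₂ v))

-- smallest HN slope; nothing encodes the zero bundle (μ_min(0) = +∞).
μmin : Bundle → Maybe ℚ
μmin V = Data.Maybe.map proj₁ (last (pieces V))
  where import Data.Maybe

_<ₘ_ : Maybe ℚ → Maybe ℚ → Set
just a  <ₘ just b  = a ℚ.< b
just a  <ₘ nothing = ⊤
nothing <ₘ _       = ⊥

Conditions : Bundle → Bundle → Bundle → Set
Conditions E F Q =
  (∀ μ → (rkLe F μ ℕ.≤ rkLe E μ) × (rkLe E μ ≡ rkLe F μ → IsoLe E F μ)) ×
  (∀ μ → (rkLe Q μ ℕ.≤ rkLe E μ) × (rkLe E μ ≡ rkLe Q μ → IsoLe E Q μ)) ×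
  (∀ μ → rkGe Q μ ℕ.≤ rkGe F μ) ×
  (μmin E <ₘ μmin F)

{-# OPTIONS --safe #-}
module Submission where

-- The HN polygon determines the HN pieces: the edge after each vertex is
-- (m · rk O(λ), m · deg O(λ)). Stretching by C keeps these horizontal lengths
-- and multiplies the vertical ones by C, so the stretched bundle has the same
-- pieces with every slope multiplied by C and every rank m · rk O(λ) unchanged.
-- As multiplication by C > 0 is an order automorphism of ℚ, the truncation of
-- the stretched bundle at C ν is the image of the original truncation at ν
-- (same rank; isomorphic exactly when the originals are), and μ_min scales by
-- C; since every μ is C ν for ν = μ / C, conditions (i)–(iv) carry over.

open import Defs
open import Data.Nat using (ℕ; _≤_; suc; s≤s; z≤n; _+_; _*_)
open import Relation.Binary.PropositionalEquality
  using (_≡_; _≢_; refl; sym; trans; cong; cong₂; subst; subst₂; module ≡-Reasoning)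

import Data.Nat.Properties as ℕₚ
import Data.Nat.Coprimality as Coprime
open import Data.Integer as ℤ using (ℤ; +_)
import Data.Integer.Properties as ℤₚ
open import Algebra.Properties.CommutativeSemigroup ℤₚ.*-commutativeSemigroup
  using (x∙yz≈xz∙y; x∙yz≈y∙xz)
open import Algebra.Bundles using (AbelianGroup)
open import Algebra.Properties.Group (AbelianGroup.group ℤₚ.+-0-abelianGroup)
  using (∙-cancelˡ)
open import Data.Rational as ℚ using (ℚ; mkℚ; mkℚ+; ↥_; ↧_; ↧ₙ_; Positive; 1/_)
import Data.Rational.Properties as ℚₚ
import Data.Rational.Unnormalised as ℚᵘ
import Data.Rational.Unnormalised.Properties as ℚᵘ
open import Data.Product using (_×_; _,_; proj₁; proj₂)
open import Data.List using ([]; _∷_; map; scanl; last)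
open import Data.List.Relation.Binary.Pointwise using (Pointwise; []; _∷_; filter⁺)
open import Data.List.Relation.Unary.All using (All; []; _∷_)
import Data.List.Properties as List
import Data.Maybe as Maybe
open import Data.Maybe.Relation.Binary.Pointwise as Maybeᴾ using (just; nothing)
open import Data.Unit using (tt)
open import Data.Empty using (⊥-elim)

Pointwise-functional : ∀ {A B : Set} {R : A → B → Set} →
  (∀ {x y z} → R x y → R x z → y ≡ z) →
  ∀ {xs ys zs} → Pointwise R xs ys → Pointwise R xs zs → ys ≡ zs
Pointwise-functional R-functional [] [] = refl
Pointwise-functional R-functional (r ∷ rs) (s ∷ ss) =
  cong₂ _∷_ (R-functional r s) (Pointwise-functional R-functional rs ss)

scanl≢[] : ∀ {A B : Set} (f : A → B → A) e xs → scanl f e xs ≢ []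
scanl≢[] f e []      ()
scanl≢[] f e (x ∷ xs) ()

[]≢map-scanl : ∀ {A B C : Set} (g : A → C) (f : A → B → A) e xs → [] ≢ map g (scanl f e xs)
[]≢map-scanl g f e []       ()
[]≢map-scanl g f e (x ∷ xs) ()

scanl-head : ∀ {A B C D : Set} {f : A → B → A} {g : C → D → C} {h : C → A} {a c} xs ys →
  scanl f a xs ≡ map h (scanl g c ys) → a ≡ h c
scanl-head []      []      eq = List.∷-injectiveˡ eq
scanl-head []      (_ ∷ _) eq = List.∷-injectiveˡ eq
scanl-head (_ ∷ _) []      eq = List.∷-injectiveˡ eq
scanl-head (_ ∷ _) (_ ∷ _) eq = List.∷-injectiveˡ eq

DominatesBelow : Bundle → Bundle → ℚ → Set
DominatesBelow V W μ = (rkLe W μ ≤ rkLe V μ) × (rkLe V μ ≡ rkLe W μ → IsoLe V W μ)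

module SlopeScaling (c : ℚ) where

  SlopeScaled : ℚ → ℚ → Set
  SlopeScaled ℓ ℓ' = ℓ' ≡ c ℚ.* ℓ

  Scaled : HNPiece → HNPiece → Set
  Scaled (ℓ , m) (ℓ' , m') = SlopeScaled ℓ ℓ' × (m' * rkO ℓ' ≡ m * rkO ℓ)

  record SlopesScaled (V V' : Bundle) : Set where
    constructor slopesScaled
    field piecewise : Pointwise Scaled (pieces V) (pieces V')
  open SlopesScaled

  Scaled-functional : ∀ {p q r} → Scaled p q → Scaled p r → q ≡ r
  Scaled-functional {q = _ , m₁} {r = _ , m₂} (refl , rk₁) (refl , rk₂) =
    cong (_ ,_) (ℕₚ.*-cancelʳ-≡ m₁ m₂ _ (trans rk₁ (sym rk₂)))

  rkPieces-scaled : ∀ {ps ps'} → Pointwise Scaled ps ps' → rkPieces ps' ≡ rkPieces ps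
  rkPieces-scaled []       = refl
  rkPieces-scaled (r ∷ rs) = cong₂ _+_ (proj₂ r) (rkPieces-scaled rs)

  lastSlope-scaled : ∀ {ps ps'} → Pointwise Scaled ps ps' →
    Maybeᴾ.Pointwise SlopeScaled (Maybe.map proj₁ (last ps)) (Maybe.map proj₁ (last ps'))
  lastSlope-scaled []           = nothing
  lastSlope-scaled (r ∷ [])     = just (proj₁ r)
  lastSlope-scaled (_ ∷ r ∷ rs) = lastSlope-scaled (r ∷ rs)

  module _ {{_ : Positive c}} where

    truncLe-scaled : ∀ ν {ps ps'} → Pointwise Scaled ps ps' →
      Pointwise Scaled (truncLe ν ps) (truncLe (c ℚ.* ν) ps')
    truncLe-scaled ν = filter⁺ _ _
      (λ { (refl , _) → ℚₚ.*-monoˡ-≤-nonNeg c {{ℚₚ.pos⇒nonNeg c}} })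
      (λ { (refl , _) → ℚₚ.*-cancelˡ-≤-pos c })

    truncGe-scaled : ∀ ν {ps ps'} → Pointwise Scaled ps ps' →
      Pointwise Scaled (truncGe ν ps) (truncGe (c ℚ.* ν) ps')
    truncGe-scaled ν = filter⁺ _ _
      (λ { (refl , _) → ℚₚ.*-monoˡ-≤-nonNeg c {{ℚₚ.pos⇒nonNeg c}} })
      (λ { (refl , _) → ℚₚ.*-cancelˡ-≤-pos c })

    rkLe-scaled : ∀ {V V'} → SlopesScaled V V' → ∀ ν → rkLe V' (c ℚ.* ν) ≡ rkLe V ν
    rkLe-scaled V↝V' ν = rkPieces-scaled (truncLe-scaled ν (piecewise V↝V'))

    rkGe-scaled : ∀ {V V'} → SlopesScaled V V' → ∀ ν → rkGe V' (c ℚ.* ν) ≡ rkGe V ν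
    rkGe-scaled V↝V' ν = rkPieces-scaled (truncGe-scaled ν (piecewise V↝V'))

    IsoLe-scaled : ∀ {V V' W W'} → SlopesScaled V V' → SlopesScaled W W' →
      ∀ ν → IsoLe V W ν → IsoLe V' W' (c ℚ.* ν)
    IsoLe-scaled {V' = V'} V↝V' W↝W' ν V≅W =
      Pointwise-functional (λ {p} → Scaled-functional {p})
      (subst (λ ps → Pointwise Scaled ps (truncLe (c ℚ.* ν) (pieces V'))) V≅W
        (truncLe-scaled ν (piecewise V↝V')))
      (truncLe-scaled ν (piecewise W↝W'))

    μmin-scaled : ∀ {V V' W W'} → SlopesScaled V V' → SlopesScaled W W' →
      μmin V <ₘ μmin W → μmin V' <ₘ μmin W'
    μmin-scaled V↝V' W↝W' =
      go (lastSlope-scaled (piecewise V↝V')) (lastSlope-scaled (piecewise W↝W'))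
      where
      go : ∀ {a a' b b'} → Maybeᴾ.Pointwise SlopeScaled a a' →
        Maybeᴾ.Pointwise SlopeScaled b b' → a <ₘ b → a' <ₘ b'
      go (just refl) (just refl) a<b = ℚₚ.*-monoʳ-<-pos c a<b
      go (just _)    nothing     _   = tt
      go nothing     _           ()

    ∀-by-scaling : {P : ℚ → Set} → (∀ ν → P (c ℚ.* ν)) → ∀ μ → P μ
    ∀-by-scaling {P} P-scaled μ = subst P c*c⁻¹μ≡μ (P-scaled (c⁻¹ ℚ.* μ))
      where
      c⁻¹ : ℚ
      c⁻¹ = (1/ c) {{ℚₚ.pos⇒nonZero c}}
      open ≡-Reasoning
      c*c⁻¹μ≡μ : c ℚ.* (c⁻¹ ℚ.* μ) ≡ μ
      c*c⁻¹μ≡μ = begin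
        c ℚ.* (c⁻¹ ℚ.* μ) ≡⟨ sym (ℚₚ.*-assoc c c⁻¹ μ) ⟩
        (c ℚ.* c⁻¹) ℚ.* μ ≡⟨ cong (ℚ._* μ) (ℚₚ.*-inverseʳ c {{ℚₚ.pos⇒nonZero c}}) ⟩
        ℚ.1ℚ ℚ.* μ        ≡⟨ ℚₚ.*-identityˡ μ ⟩
        μ                  ∎

    DominatesBelow-scaled : ∀ {V V' W W'} → SlopesScaled V V' → SlopesScaled W W' →
      ∀ ν → DominatesBelow V W ν → DominatesBelow V' W' (c ℚ.* ν)
    DominatesBelow-scaled V↝V' W↝W' ν (rkW≤rkV , rk≡⇒iso) =
      subst₂ _≤_ (sym rkW'≡rkW) (sym rkV'≡rkV) rkW≤rkV ,
      λ rk'≡ → IsoLe-scaled V↝V' W↝W' ν (rk≡⇒iso (trans (sym rkV'≡rkV) (trans rk'≡ rkW'≡rkW)))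
      where
      rkV'≡rkV = rkLe-scaled V↝V' ν
      rkW'≡rkW = rkLe-scaled W↝W' ν

    Conditions-scaled : ∀ {E E' F F' Q Q'} →
      SlopesScaled E E' → SlopesScaled F F' → SlopesScaled Q Q' →
      Conditions E F Q → Conditions E' F' Q'
    Conditions-scaled E↝E' F↝F' Q↝Q' (E≽F , E≽Q , rkGeQ≤rkGeF , μE<μF) =
      ∀-by-scaling (λ ν → DominatesBelow-scaled E↝E' F↝F' ν (E≽F ν)) ,
      ∀-by-scaling (λ ν → DominatesBelow-scaled E↝E' Q↝Q' ν (E≽Q ν)) ,
      ∀-by-scaling (λ ν → subst₂ _≤_ (sym (rkGe-scaled Q↝Q' ν)) (sym (rkGe-scaled F↝F' ν))
                                      (rkGeQ≤rkGeF ν)) ,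
      μmin-scaled E↝E' F↝F' μE<μF

proportional⇒cross-multiplied : ∀ k c m n n' d d' .{{_ : ℤ.NonZero k}} →
  k ℤ.* n' ≡ c ℤ.* (m ℤ.* n) → k ℤ.* d' ≡ m ℤ.* d → n' ℤ.* d ≡ (c ℤ.* n) ℤ.* d'
proportional⇒cross-multiplied k c m n n' d d' kn'≡cmn kd'≡md =
  ℤₚ.*-cancelˡ-≡ k _ _ (begin
    k ℤ.* (n' ℤ.* d)           ≡⟨ sym (ℤₚ.*-assoc k n' d) ⟩
    (k ℤ.* n') ℤ.* d           ≡⟨ cong (ℤ._* d) kn'≡cmn ⟩
    (c ℤ.* (m ℤ.* n)) ℤ.* d    ≡⟨ cong (ℤ._* d) (x∙yz≈xz∙y c m n) ⟩
    ((c ℤ.* n) ℤ.* m) ℤ.* d    ≡⟨ ℤₚ.*-assoc (c ℤ.* n) m d ⟩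
    (c ℤ.* n) ℤ.* (m ℤ.* d)    ≡⟨ cong ((c ℤ.* n) ℤ.*_) (sym kd'≡md) ⟩
    (c ℤ.* n) ℤ.* (k ℤ.* d')   ≡⟨ x∙yz≈y∙xz (c ℤ.* n) k d' ⟩
    k ℤ.* ((c ℤ.* n) ℤ.* d')   ∎)
  where open ≡-Reasoning

module Stretching (C : ℕ) where

  C/1 : ℚ
  C/1 = mkℚ+ C 1 (Coprime.sym (Coprime.1-coprimeTo C))

  open SlopeScaling C/1

  stretchVertex : ℤ × ℤ → ℤ × ℤ
  stretchVertex v = (proj₁ v , + C ℤ.* proj₂ v)

  stretched-increment⇒slope : ∀ ℓ ℓ' m m' → 1 ≤ m' →
    m' * rkO ℓ' ≡ m * rkO ℓ → + m' ℤ.* ↥ ℓ' ≡ + C ℤ.* (+ m ℤ.* ↥ ℓ) → ℓ' ≡ C/1 ℚ.* ℓ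
  stretched-increment⇒slope ℓ@(mkℚ _ _ _) ℓ'@(mkℚ _ _ _) m m'@(suc _) _ rk-eq deg-eq =
    ℚₚ.toℚᵘ-injective (ℚᵘ.≃-trans (ℚᵘ.*≡* cross) (ℚᵘ.≃-sym (ℚₚ.toℚᵘ-homo-* C/1 ℓ)))
    where
    rk-eqℤ : + m' ℤ.* ↧ ℓ' ≡ + m ℤ.* ↧ ℓ
    rk-eqℤ = trans (sym (ℤₚ.pos-* m' _)) (trans (cong +_ rk-eq) (ℤₚ.pos-* m _))
    -- + (1 * ↧ₙ ℓ) is the denominator of the unnormalised product C/1 · ℓ
    cross : ↥ ℓ' ℤ.* + (1 * ↧ₙ ℓ) ≡ (+ C ℤ.* ↥ ℓ) ℤ.* ↧ ℓ'
    cross = subst (λ d → ↥ ℓ' ℤ.* + d ≡ (+ C ℤ.* ↥ ℓ) ℤ.* ↧ ℓ') (sym (ℕₚ.*-identityˡ _))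
      (proportional⇒cross-multiplied (+ m') (+ C) (+ m) (↥ ℓ) (↥ ℓ') (↧ ℓ) (↧ ℓ') deg-eq rk-eqℤ)

  step-stretched⇒Scaled : ∀ w p p' → 1 ≤ proj₂ p' →
    step (stretchVertex w) p' ≡ stretchVertex (step w p) → Scaled p p'
  step-stretched⇒Scaled (x , y) (ℓ , m) (ℓ' , m') m'≥1 eq =
    stretched-increment⇒slope ℓ ℓ' m m' m'≥1 rk-eq deg-eq , rk-eq
    where
    rk-eq : m' * rkO ℓ' ≡ m * rkO ℓ
    rk-eq = ℤₚ.+-injective (∙-cancelˡ x _ _ (cong proj₁ eq))
    deg-eq : + m' ℤ.* ↥ ℓ' ≡ + C ℤ.* (+ m ℤ.* ↥ ℓ)
    deg-eq = ∙-cancelˡ (+ C ℤ.* y) _ _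
      (trans (cong proj₂ eq) (ℤₚ.*-distribˡ-+ (+ C) y (+ m ℤ.* ↥ ℓ)))

  scanl-stretched⇒Scaled : ∀ {v w} ps ps' → All (λ p → 1 ≤ proj₂ p) ps' → v ≡ stretchVertex w →
    scanl step v ps' ≡ map stretchVertex (scanl step w ps) → Pointwise Scaled ps ps'
  scanl-stretched⇒Scaled [] [] _ _ _ = []
  scanl-stretched⇒Scaled [] (p' ∷ ps') _ _ eq =
    ⊥-elim (scanl≢[] step _ ps' (List.∷-injectiveʳ eq))
  scanl-stretched⇒Scaled (p ∷ ps) [] _ _ eq =
    ⊥-elim ([]≢map-scanl stretchVertex step _ ps (List.∷-injectiveʳ eq))
  scanl-stretched⇒Scaled {w = w} (p ∷ ps) (p' ∷ ps') (m'≥1 ∷ ms≥1) refl eq =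
    step-stretched⇒Scaled w p p' m'≥1 next-vertex ∷
    scanl-stretched⇒Scaled ps ps' ms≥1 next-vertex rest
    where
    rest = List.∷-injectiveʳ eq
    next-vertex = scanl-head ps' ps rest

  HN-stretched⇒SlopesScaled : ∀ V V' → HN V' ≡ stretch C (HN V) → SlopesScaled V V'
  HN-stretched⇒SlopesScaled V V' eq = slopesScaled
    (scanl-stretched⇒Scaled (pieces V) (pieces V') (positive V')
                            (scanl-head (pieces V') (pieces V) eq) eq)

lemma4p25 : (E F Q : Bundle) → Conditions E F Q →
            (C : ℕ) → 1 ≤ C →
            (E' F' Q' : Bundle) →
            HN E' ≡ stretch C (HN E) →
            HN F' ≡ stretch C (HN F) →
            HN Q' ≡ stretch C (HN Q) →
            Conditions E' F' Q'
lemma4p25 E F Q conditions (suc k) (s≤s z≤n) E' F' Q' E'-stretched F'-stretched Q'-stretched =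
  Conditions-scaled (HN-stretched⇒SlopesScaled E E' E'-stretched)
                    (HN-stretched⇒SlopesScaled F F' F'-stretched)
                    (HN-stretched⇒SlopesScaled Q Q' Q'-stretched) conditions
  where
  open Stretching (suc k)
  open SlopeScaling C/1
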